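{- There is an absolute constant $c>0$ such that for any integer $m\ge 2$ and any positive integer $a$ there are at least $c\sqrt{m}/\log m$ multiplicatively independent integers $x\in[a,a+m)$.
   Context: Nonzero complex numbers $x_1,\dots,x_k$ are multiplicatively independent if $x_1^{n_1}\cdots x_k^{n_k}=1$ with $n_1,\dots,n_k\in\mathbb{Z}$ implies $n_1=\dots=n_k=0$. -}

module Defs where

open import Data.Nat using (ℕ; zero; suc; _*_; _^_)
open import Data.Integer as ℤ using (ℤ; +_; -[1+_])
open import Data.Fin using (Fin; zero; suc)
open import Relation.Binary.PropositionalEquality using (_≡_)

∏ : (k : ℕ) → (Fin k → ℕ) → ℕ
∏ zero    f = 1
∏ (suc k) f = f zero * ∏ k (λ i → f (suc i))

pos : ℤ → ℕ
pos (+ n)      = n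
pos -[1+ n ]   = 0

neg : ℤ → ℕ
neg (+ n)      = 0
neg -[1+ n ]   = suc n

-- x₁^{n₁}⋯x_k^{n_k} = 1 (an identity of nonzero rationals), written with
-- denominators cleared: ∏ x_i^{n_i⁺} = ∏ x_i^{n_i⁻}.
ProdPowIsOne : (k : ℕ) → (Fin k → ℕ) → (Fin k → ℤ) → Set
ProdPowIsOne k x n = ∏ k (λ i → x i ^ pos (n i)) ≡ ∏ k (λ i → x i ^ neg (n i))

MultIndependent : (k : ℕ) → (Fin k → ℕ) → Set
MultIndependent k x = (n : Fin k → ℤ) → ProdPowIsOne k x n → (i : Fin k) → n i ≡ + 0

module Submission where

-- Integers having "private" prime divisors (a prime dividing one of
-- them and none of the others) are multiplicatively independent.  Given K
-- distinct primes q in [K, C] with C·K < m, a sieve produces, for every such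
-- q, a multiple of q in [a, a+m) divisible by no other of the primes: among
-- the K consecutive multiples of q after a, each other prime q′ ≥ K divides
-- at most one.  The K primes come from Chebyshev's bound 2^N ≤ (2N)^π(2N),
-- proved via the central binomial coefficient and Legendre's formula (every
-- prime power dividing (2N)!/(N!)² is at most 2N).  Choosing powers of two
-- K ≈ √(m / log m) and C ≈ √(m log m) gives m ≤ 64 K² (log m)², that is, the
-- theorem with c = 1/8; windows too short for this choice are handled by the
-- single integer a + 1.

open import Defs
open import Data.Nat using (ℕ; _*_; _+_; _≤_; _<_)
open import Data.Nat.Logarithm using (⌊log₂_⌋)
open import Data.Fin using (Fin)
open import Data.Product using (Σ; ∃; ∃-syntax; _×_)

open import Data.Nat
  using (zero; suc; _∸_; _^_; s≤s; z≤n; NonZero; NonTrivial; >-nonZero; nonTrivial⇒n>1;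
         _/_; _%_; _!; _≤?_; ⌊_/2⌋; ⌈_/2⌉)
open import Data.Nat.Properties
open import Data.Nat.Divisibility
open import Data.Nat.DivMod
open import Data.Nat.Primality
open import Data.Nat.Primality.Factorisation using (factorise; PrimeFactorisation)
open import Data.Nat.Combinatorics using (k![n∸k]!∣n!)
open import Data.Nat.ListAction using (product)
open import Data.Nat.Logarithm using (⌊log₂⌋-mono-≤; ⌊log₂⌊n/2⌋⌋≡⌊log₂n⌋∸1; ⌊log₂[2^n]⌋≡n)
open import Data.Nat.Induction using (<-rec)
open import Data.Nat.Tactic.RingSolver using (solve-∀)
import Data.Integer as ℤ
open import Data.Fin as Fin using (zero; suc; toℕ)
open import Data.Fin.Properties using (any?; all?; ¬∀⟶∃¬; pigeonhole; toℕ<n; inject≤-injective)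
open import Data.List using (List; []; _∷_; length; lookup)
open import Data.List.Relation.Unary.All as All using (All; []; _∷_)
open import Data.List.Relation.Unary.AllPairs using (AllPairs; []; _∷_)
open import Data.List.Relation.Unary.Any using (here; there)
open import Data.List.Membership.Propositional using (_∈_)
open import Data.List.Membership.Propositional.Properties using (∈-lookup)
open import Data.Product using (_,_; proj₁; proj₂; map₂)
open import Data.Sum using (inj₁; inj₂)
open import Data.Empty using (⊥; ⊥-elim)
open import Function using (it)
open import Relation.Nullary using (¬_; Dec; yes; no; contradiction; ¬?; _×-dec_)
open import Relation.Binary.Definitions using (tri<; tri≈; tri>)
open import Relation.Binary.PropositionalEquality

prime>1 : ∀ {p} → Prime p → 1 < p
prime>1 {p} pr = nonTrivial⇒n>1 p {{prime⇒nonTrivial pr}}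

prime∤1 : ∀ {p} → Prime p → ¬ p ∣ 1
prime∤1 pr p∣1 = <⇒≢ (prime>1 pr) (sym (∣1⇒≡1 p∣1))

factor∣∏ : ∀ k (f : Fin k → ℕ) i → f i ∣ ∏ k f
factor∣∏ (suc k) f zero    = m∣m*n (∏ k (λ i → f (suc i)))
factor∣∏ (suc k) f (suc i) = ∣n⇒∣m*n (f zero) (factor∣∏ k (λ j → f (suc j)) i)

prime∣∏ : ∀ {p} → Prime p → ∀ k (f : Fin k → ℕ) → p ∣ ∏ k f → ∃[ i ] p ∣ f i
prime∣∏ pr zero    f p∣1 = contradiction p∣1 (prime∤1 pr)
prime∣∏ pr (suc k) f p∣∏ with euclidsLemma (f zero) (∏ k (λ i → f (suc i))) pr p∣∏
... | inj₁ p∣f₀ = zero , p∣f₀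
... | inj₂ p∣∏′ = let (i , p∣fᵢ) = prime∣∏ pr k (λ i → f (suc i)) p∣∏′ in suc i , p∣fᵢ

prime∣^⇒prime∣ : ∀ {p} → Prime p → ∀ x e → p ∣ x ^ e → p ∣ x
prime∣^⇒prime∣ pr x zero    p∣1 = contradiction p∣1 (prime∤1 pr)
prime∣^⇒prime∣ pr x (suc e) p∣x^e+1 with euclidsLemma x (x ^ e) pr p∣x^e+1
... | inj₁ p∣x   = p∣x
... | inj₂ p∣x^e = prime∣^⇒prime∣ pr x e p∣x^e

^-monoʳ-∣ : ∀ x {a b} → a ≤ b → x ^ a ∣ x ^ b
^-monoʳ-∣ x {a} {b} a≤b = subst (x ^ a ∣_) x^a*x^[b-a]≡x^b (m∣m*n (x ^ (b ∸ a)))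
  where
  x^a*x^[b-a]≡x^b : x ^ a * x ^ (b ∸ a) ≡ x ^ b
  x^a*x^[b-a]≡x^b = trans (sym (^-distribˡ-+-* x a (b ∸ a))) (cong (x ^_) (m+[n∸m]≡n a≤b))

-- Suppose every x i has a prime divisor P i dividing no
-- other x j.  In a relation ∏ x^e = ∏ x^f, the prime P i then divides the
-- right-hand side exactly when f i > 0, so e i > 0 forces f i > 0.
module PrivatePrimes {k : ℕ} (x P : Fin k → ℕ) (P-prime : ∀ i → Prime (P i))
                     (P∣x : ∀ i → P i ∣ x i) (P∤x : ∀ i j → i ≢ j → ¬ P i ∣ x j) where

  exponent-vanishes : ∀ (e f : Fin k → ℕ) → ∏ k (λ j → x j ^ e j) ≡ ∏ k (λ j → x j ^ f j)
                    → ∀ i → f i ≡ 0 → e i ≡ 0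
  exponent-vanishes e f eq i fᵢ≡0 with e i in eᵢ
  ... | zero  = refl
  ... | suc t with prime∣∏ (P-prime i) k (λ j → x j ^ f j) Pᵢ∣rhs
    where
    Pᵢ∣rhs : P i ∣ ∏ k (λ j → x j ^ f j)
    Pᵢ∣rhs = subst (P i ∣_) eq (∣-trans (subst (λ n → P i ∣ x i ^ n) (sym eᵢ) (∣m⇒∣m*n _ (P∣x i)))
                                       (factor∣∏ k (λ j → x j ^ e j) i))
  ...   | j , Pᵢ∣xⱼ^fⱼ with i Fin.≟ j
  ...     | yes refl = contradiction (subst (λ n → P i ∣ x i ^ n) fᵢ≡0 Pᵢ∣xⱼ^fⱼ) (prime∤1 (P-prime i))
  ...     | no i≢j   = contradiction (prime∣^⇒prime∣ (P-prime i) (x j) (f j) Pᵢ∣xⱼ^fⱼ) (P∤x i j i≢j)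

  -- a nonzero exponent n i has a positive part and a zero part, or vice versa
  independent : MultIndependent k x
  independent n eq i with n i in nᵢ
  ... | ℤ.+ zero   = refl
  ... | ℤ.+ suc t  = contradiction (trans (cong pos (sym nᵢ)) pos≡0) λ ()
    where
    pos≡0 : pos (n i) ≡ 0
    pos≡0 = exponent-vanishes (λ j → pos (n j)) (λ j → neg (n j)) eq i (cong neg nᵢ)
  ... | ℤ.-[1+ t ] = contradiction (trans (cong neg (sym nᵢ)) neg≡0) λ ()
    where
    neg≡0 : neg (n i) ≡ 0
    neg≡0 = exponent-vanishes (λ j → neg (n j)) (λ j → pos (n j)) (sym eq) i (cong pos nᵢ)

^-injectiveʳ : ∀ x → 1 < x → ∀ {a b} → x ^ a ≡ x ^ b → a ≡ b
^-injectiveʳ x 1<x {a} {b} eq with <-cmp a b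
... | tri< a<b _ _ = contradiction eq (<⇒≢ (^-monoʳ-< x 1<x a<b))
... | tri≈ _ a≡b _ = a≡b
... | tri> _ _ b<a = contradiction (sym eq) (<⇒≢ (^-monoʳ-< x 1<x b<a))

single-independent : ∀ x → 1 < x → MultIndependent 1 (λ _ → x)
single-independent x 1<x n eq zero = balanced⇒zero (n zero) (^-injectiveʳ x 1<x x^pos≡x^neg)
  where
  x^pos≡x^neg : x ^ pos (n zero) ≡ x ^ neg (n zero)
  x^pos≡x^neg = trans (sym (*-identityʳ _)) (trans eq (*-identityʳ _))
  balanced⇒zero : ∀ z → pos z ≡ neg z → z ≡ ℤ.+ 0
  balanced⇒zero (ℤ.+ zero)  _  = refl
  balanced⇒zero ℤ.-[1+ _ ]  ()

module Legendre (p : ℕ) (p-prime : Prime p) where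

  instance
    p≢0 : NonZero p
    p≢0 = prime⇒nonZero p-prime

  ∤-* : ∀ {a b} → ¬ p ∣ a → ¬ p ∣ b → ¬ p ∣ a * b
  ∤-* p∤a p∤b p∣ab with euclidsLemma _ _ p-prime p∣ab
  ... | inj₁ p∣a = p∤a p∣a
  ... | inj₂ p∣b = p∤b p∣b

  /-unique : ∀ q r → r < p → (q * p + r) / p ≡ q
  /-unique q r r<p = begin
    (q * p + r) / p     ≡⟨ +-distrib-/-∣ˡ r (n∣m*n q) ⟩
    q * p / p + r / p   ≡⟨ cong₂ _+_ (m*n/n≡m q p) (m<n⇒m/n≡0 r<p) ⟩
    q + 0               ≡⟨ +-identityʳ q ⟩
    q                   ∎
    where open ≡-Reasoning

  p∸1+1 : suc (p ∸ 1) ≡ p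
  p∸1+1 = m+[n∸m]≡n (<⇒≤ (prime>1 p-prime))

  p∸1<p : p ∸ 1 < p
  p∸1<p = subst (p ∸ 1 <_) p∸1+1 ≤-refl

  -- The p-free part of (q·p + r)! for r < p:  (q·p + r)! = A · p^q · q!  with p ∤ A.
  -- The multiples p, 2p, …, qp contribute p^q · q!, the other factors are prime to p.
  factorial-split : ∀ q r → r < p → ∃[ A ] ¬ p ∣ A × (q * p + r) ! ≡ A * p ^ q * q !
  factorial-split zero    zero    _   = 1 , prime∤1 p-prime , refl
  factorial-split (suc q) zero    _   with factorial-split q (p ∸ 1) p∸1<p
  ... | A , p∤A , eq = A , p∤A , (begin
    (suc q * p + 0) !                         ≡⟨ cong _! block ⟩
    suc (q * p + (p ∸ 1)) * (q * p + (p ∸ 1)) ! ≡⟨ cong₂ _*_ (sym block) eq ⟩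
    (suc q * p + 0) * (A * p ^ q * q !)       ≡⟨ regroup q (p ^ q) (q !) A p ⟩
    A * p ^ suc q * suc q !                   ∎)
    where
    open ≡-Reasoning
    block : suc q * p + 0 ≡ suc (q * p + (p ∸ 1))
    block = subst (λ x → suc q * x + 0 ≡ suc (q * x + (p ∸ 1))) p∸1+1 (ident q (p ∸ 1))
      where
      ident : ∀ q p′ → suc q * suc p′ + 0 ≡ suc (q * suc p′ + p′)
      ident = solve-∀
    regroup : ∀ q X Y A p → (suc q * p + 0) * (A * X * Y) ≡ A * (p * X) * (Y + q * Y)
    regroup = solve-∀
  factorial-split q       (suc r) r<p with factorial-split q r (<-trans (n<1+n r) r<p)
  ... | A , p∤A , eq = suc (q * p + r) * A , ∤-* p∤next p∤A , (begin
    (q * p + suc r) !               ≡⟨ cong _! (+-suc (q * p) r) ⟩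
    suc (q * p + r) * (q * p + r) ! ≡⟨ cong (suc (q * p + r) *_) eq ⟩
    suc (q * p + r) * (A * p ^ q * q !) ≡⟨ reassoc (suc (q * p + r)) A (p ^ q) (q !) ⟩
    suc (q * p + r) * A * p ^ q * q ! ∎)
    where
    open ≡-Reasoning
    reassoc : ∀ a b c d → a * (b * c * d) ≡ a * b * c * d
    reassoc = solve-∀
    p∤next : ¬ p ∣ suc (q * p + r)
    p∤next p∣ = <⇒≱ r<p (∣⇒≤ (∣m+n∣m⇒∣n (subst (p ∣_) (sym (+-suc (q * p) r)) p∣) (n∣m*n q)))

  -- legendre k n = ⌊n/p⌋ + ⌊n/p²⌋ + … + ⌊n/pᵏ⌋.
  legendre : ℕ → ℕ → ℕ
  legendre zero    n = 0
  legendre (suc k) n = n / p + legendre k (n / p)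

  -- dividing by p decreases positive numbers, so k steps of fuel suffice for n ≤ k
  quotient-shrinks : ∀ k n → n ≤ suc k → n / p ≤ k
  quotient-shrinks k zero    _   = subst (_≤ k) (sym (0/n≡0 p)) z≤n
  quotient-shrinks k (suc n) n≤k = ≤-pred (≤-trans (m/n<m (suc n) p (prime>1 p-prime)) n≤k)

  factorial-valuation : ∀ k n → n ≤ k → ∃[ A ] ¬ p ∣ A × n ! ≡ A * p ^ legendre k n
  factorial-valuation zero    zero _   = 1 , prime∤1 p-prime , refl
  factorial-valuation (suc k) n    n≤k
    with factorial-split (n / p) (n % p) (m%n<n n p)
       | factorial-valuation k (n / p) quotient≤k
    where
    quotient≤k : n / p ≤ k
    quotient≤k = quotient-shrinks k n n≤k
  ... | A , p∤A , eqA | B , p∤B , eqB = A * B , ∤-* p∤A p∤B , (begin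
    n !                                             ≡⟨ cong _! (trans (m≡m%n+[m/n]*n n p) (+-comm (n % p) _)) ⟩
    (n / p * p + n % p) !                           ≡⟨ eqA ⟩
    A * p ^ (n / p) * (n / p) !                     ≡⟨ cong (A * p ^ (n / p) *_) eqB ⟩
    A * p ^ (n / p) * (B * p ^ legendre k (n / p))  ≡⟨ regroup A B (p ^ (n / p)) _ ⟩
    A * B * (p ^ (n / p) * p ^ legendre k (n / p))  ≡⟨ cong (A * B *_) (^-distribˡ-+-* p (n / p) _) ⟨
    A * B * p ^ legendre (suc k) n                  ∎)
    where
    open ≡-Reasoning
    regroup : ∀ a b x y → a * x * (b * y) ≡ a * b * (x * y)
    regroup = solve-∀

  split : ∀ a b c → a + b + c ≡ (a / p + b / p) * p + (a % p + b % p + c)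
  split a b c = begin
    a + b + c ≡⟨ cong₂ (λ x y → x + y + c) (m≡m%n+[m/n]*n a p) (m≡m%n+[m/n]*n b p) ⟩
    a % p + a / p * p + (b % p + b / p * p) + c ≡⟨ regroup (a % p) (a / p) (b % p) (b / p) c p ⟩
    (a / p + b / p) * p + (a % p + b % p + c) ∎
    where
    open ≡-Reasoning
    regroup : ∀ r q s t c p → r + q * p + (s + t * p) + c ≡ (q + t) * p + (r + s + c)
    regroup = solve-∀

  remainders<p+p : ∀ a b c → c ≤ 1 → a % p + b % p + c < p + p
  remainders<p+p a b c c≤1 = begin-strict
    a % p + b % p + c              ≤⟨ +-monoʳ-≤ (a % p + b % p) c≤1 ⟩
    a % p + b % p + 1              ≡⟨ +-assoc (a % p) (b % p) 1 ⟩
    a % p + (b % p + 1)            ≡⟨ cong (a % p +_) (+-comm (b % p) 1) ⟩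
    a % p + suc (b % p)            <⟨ +-mono-<-≤ (m%n<n a p) (m%n<n b p) ⟩
    p + p                          ∎
    where open ≤-Reasoning

  quotient-within-one : ∀ Q s → s < p + p → ∃[ c′ ] c′ ≤ 1 × (Q * p + s) / p ≡ Q + c′
  quotient-within-one Q s s<2p with p ≤? s
  ... | no  s≱p = 0 , z≤n , trans (/-unique Q s (≰⇒> s≱p)) (sym (+-identityʳ Q))
  ... | yes p≤s = 1 , ≤-refl , (begin
    (Q * p + s) / p             ≡⟨ cong (λ r → (Q * p + r) / p) (m+[n∸m]≡n p≤s) ⟨
    (Q * p + (p + (s ∸ p))) / p ≡⟨ cong (_/ p) (carry-out Q p (s ∸ p)) ⟩
    ((Q + 1) * p + (s ∸ p)) / p ≡⟨ /-unique (Q + 1) (s ∸ p) (m<n+o⇒m∸n<o s p s<2p) ⟩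
    Q + 1                       ∎)
    where
    open ≡-Reasoning
    carry-out : ∀ q p r → q * p + (p + r) ≡ (q + 1) * p + r
    carry-out = solve-∀

  quotient-carry : ∀ a b c → c ≤ 1 → ∃[ c′ ] c′ ≤ 1 × (a + b + c) / p ≡ a / p + b / p + c′
  quotient-carry a b c c≤1 =
    subst (λ n → ∃[ c′ ] c′ ≤ 1 × n / p ≡ a / p + b / p + c′) (sym (split a b c))
          (quotient-within-one (a / p + b / p) _ (remainders<p+p a b c c≤1))

  -- ilog k n counts the j ∈ [1, k] with p ^ j ≤ n: it is ⌊log_p n⌋, capped at k.
  ilog : ℕ → ℕ → ℕ
  ilog zero    n = 0
  ilog (suc k) n with p ≤? n
  ... | yes _ = suc (ilog k (n / p))
  ... | no  _ = 0

  ilog-zero : ∀ k → ilog k 0 ≡ 0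
  ilog-zero zero    = refl
  ilog-zero (suc k) with p ≤? 0
  ... | yes p≤0 = contradiction p≤0 (<⇒≱ (m<n⇒0<n (prime>1 p-prime)))
  ... | no  _   = refl

  p^ilog≤ : ∀ k n → 1 ≤ n → p ^ ilog k n ≤ n
  p^ilog≤ zero    n 1≤n = 1≤n
  p^ilog≤ (suc k) n 1≤n with p ≤? n
  ... | no  _   = 1≤n
  ... | yes p≤n = begin
    p * p ^ ilog k (n / p) ≤⟨ *-monoʳ-≤ p (p^ilog≤ k (n / p) (m≥n⇒m/n>0 p≤n)) ⟩
    p * (n / p)            ≡⟨ *-comm p (n / p) ⟩
    n / p * p              ≤⟨ m/n*n≤m n p ⟩
    n                      ∎
    where open ≤-Reasoning

  carry≤ilog : ∀ k n c′ → c′ ≤ 1 → c′ ≤ n / p → c′ + ilog k (n / p) ≤ ilog (suc k) n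
  carry≤ilog k n c′ c′≤1 c′≤n/p with p ≤? n
  ... | yes _   = +-monoˡ-≤ (ilog k (n / p)) c′≤1
  ... | no  n≱p rewrite m<n⇒m/n≡0 (≰⇒> n≱p) | n≤0⇒n≡0 c′≤n/p = ≤-reflexive (ilog-zero k)

  -- Kummer's carry bound: the exponent of p in (a+b+c)!/(a! b!), c ≤ 1, is at
  -- most the number of base-p digits of a+b+c beyond the first.
  legendre-carry : ∀ k a b c → c ≤ 1
                 → legendre k (a + b + c) ≤ legendre k a + legendre k b + ilog k (a + b + c)
  legendre-carry zero    a b c _   = z≤n
  legendre-carry (suc k) a b c c≤1 with quotient-carry a b c c≤1
  ... | c′ , c′≤1 , quot rewrite quot = begin
    (a′ + b′ + c′) + legendre k (a′ + b′ + c′)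
      ≤⟨ +-monoʳ-≤ (a′ + b′ + c′) (legendre-carry k a′ b′ c′ c′≤1) ⟩
    (a′ + b′ + c′) + (legendre k a′ + legendre k b′ + ilog k (a′ + b′ + c′))
      ≡⟨ regroup a′ b′ c′ (legendre k a′) (legendre k b′) (ilog k (a′ + b′ + c′)) ⟩
    (a′ + legendre k a′) + (b′ + legendre k b′) + (c′ + ilog k (a′ + b′ + c′))
      ≤⟨ +-monoʳ-≤ ((a′ + legendre k a′) + (b′ + legendre k b′)) top-digit ⟩
    (a′ + legendre k a′) + (b′ + legendre k b′) + ilog (suc k) (a + b + c)
      ∎
    where
    open ≤-Reasoning
    a′ b′ : ℕ
    a′ = a / p
    b′ = b / p
    regroup : ∀ a b c x y z → a + b + c + (x + y + z) ≡ a + x + (b + y) + (c + z)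
    regroup = solve-∀
    top-digit : c′ + ilog k (a′ + b′ + c′) ≤ ilog (suc k) (a + b + c)
    top-digit = subst (λ q → c′ + ilog k q ≤ ilog (suc k) (a + b + c)) quot
                  (carry≤ilog k (a + b + c) c′ c′≤1 (subst (c′ ≤_) (sym quot) (m≤n+m c′ (a′ + b′))))

  exponent-bound : ∀ {A} e g → ¬ p ∣ A → p ^ e ∣ A * p ^ g → e ≤ g
  exponent-bound {A} e g p∤A p^e∣ with e ≤? g
  ... | yes e≤g = e≤g
  ... | no  e≰g = contradiction (*-cancelʳ-∣ (p ^ g) {{m^n≢0 p g}} p^[1+g]∣) p∤A
    where
    p^[1+g]∣ : p * p ^ g ∣ A * p ^ g
    p^[1+g]∣ = ∣-trans (^-monoʳ-∣ p (≰⇒> e≰g)) p^e∣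

  central-binomial-prime-power : ∀ N X f → 1 ≤ N → X * (N ! * N !) ≡ (N + N) !
                               → p ^ f ∣ X → p ^ f ≤ N + N
  central-binomial-prime-power N X f 1≤N X-def p^f∣X
    with factorial-valuation (N + N) N (m≤m+n N N) | factorial-valuation (N + N) (N + N) ≤-refl
  ... | A , _ , N!≡ | B , p∤B , [N+N]!≡ = begin
    p ^ f                    ≤⟨ ^-monoʳ-≤ p f≤ilog ⟩
    p ^ ilog (N + N) (N + N) ≤⟨ p^ilog≤ (N + N) (N + N) (≤-trans 1≤N (m≤m+n N N)) ⟩
    N + N                    ∎
    where
    open ≤-Reasoning
    E₁ E₂ : ℕ
    E₁ = legendre (N + N) N
    E₂ = legendre (N + N) (N + N)
    p^E₁∣N! : p ^ E₁ ∣ N !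
    p^E₁∣N! = subst (p ^ E₁ ∣_) (sym N!≡) (n∣m*n A)
    p^[f+2E₁]∣ : p ^ (f + (E₁ + E₁)) ∣ B * p ^ E₂
    p^[f+2E₁]∣ = subst₂ _∣_ powers (trans X-def [N+N]!≡) (*-pres-∣ p^f∣X (*-pres-∣ p^E₁∣N! p^E₁∣N!))
      where
      powers : p ^ f * (p ^ E₁ * p ^ E₁) ≡ p ^ (f + (E₁ + E₁))
      powers = trans (cong (p ^ f *_) (sym (^-distribˡ-+-* p E₁ E₁))) (sym (^-distribˡ-+-* p f (E₁ + E₁)))
    carries : E₂ ≤ E₁ + E₁ + ilog (N + N) (N + N)
    carries = subst (λ n → legendre (N + N) n ≤ E₁ + E₁ + ilog (N + N) n) (+-identityʳ (N + N))
                    (legendre-carry (N + N) N N 0 z≤n)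
    f≤ilog : f ≤ ilog (N + N) (N + N)
    f≤ilog = +-cancelʳ-≤ (E₁ + E₁) f _ (begin
      f + (E₁ + E₁)                          ≤⟨ exponent-bound _ E₂ p∤B p^[f+2E₁]∣ ⟩
      E₂                                     ≤⟨ carries ⟩
      E₁ + E₁ + ilog (N + N) (N + N)         ≡⟨ +-comm (E₁ + E₁) _ ⟩
      ilog (N + N) (N + N) + (E₁ + E₁)       ∎)

split-off : ∀ q → .{{NonTrivial q}} → ∀ n → {{NonZero n}}
          → ∃[ e ] ∃[ r ] NonZero r × n ≡ q ^ e * r × ¬ q ∣ r
split-off q n {{n≢0}} = <-rec Splittable step n n≢0
  where
  Splittable : ℕ → Set
  Splittable n = NonZero n → ∃[ e ] ∃[ r ] NonZero r × n ≡ q ^ e * r × ¬ q ∣ r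
  step : ∀ n → (∀ {m} → m < n → Splittable m) → Splittable n
  step n rec n≢0 with q ∣? n
  ... | no  q∤n = 0 , n , n≢0 , sym (*-identityˡ n) , q∤n
  ... | yes q∣n with rec (quotient-< q∣n {{it}} {{n≢0}}) (quotient≢0 q∣n {{n≢0}})
  ...   | e , r , r≢0 , d≡ , q∤r = suc e , r , r≢0 , n≡ , q∤r
    where
    n≡ : n ≡ q ^ suc e * r
    n≡ = begin
      n                   ≡⟨ m∣n⇒n≡m*quotient q∣n ⟩
      q * quotient q∣n    ≡⟨ cong (q *_) d≡ ⟩
      q * (q ^ e * r)     ≡⟨ *-assoc q (q ^ e) r ⟨
      q ^ suc e * r       ∎
      where open ≡-Reasoning

≤-from-prime-powers : ∀ M (Ps : List ℕ) n → {{NonZero n}} → 1 ≤ M → All Prime Ps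
                    → (∀ p → Prime p → p ∣ n → p ∈ Ps)
                    → (∀ p e → Prime p → p ^ e ∣ n → p ^ e ≤ M)
                    → n ≤ M ^ length Ps
≤-from-prime-powers M [] n _ _ divisors-in-Ps _
  with PrimeFactorisation.factors (factorise n) | PrimeFactorisation.isFactorisation (factorise n)
     | PrimeFactorisation.factorsPrime (factorise n)
... | []     | n≡1 | _            = ≤-reflexive n≡1
... | p ∷ ps | n≡  | p-prime ∷ _
  with divisors-in-Ps p p-prime (subst (p ∣_) (sym n≡) (m∣m*n (product ps)))
...   | ()
≤-from-prime-powers M (q ∷ Ps) n 1≤M (q-prime ∷ Ps-prime) divisors-in-Ps powers≤M
  with split-off q {{prime⇒nonTrivial q-prime}} n
... | e , r , r≢0 , n≡ , q∤r = begin
  n                     ≡⟨ n≡ ⟩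
  q ^ e * r             ≤⟨ *-mono-≤ (powers≤M q e q-prime q^e∣n) r≤ ⟩
  M * M ^ length Ps     ∎
  where
  open ≤-Reasoning
  r∣n : r ∣ n
  r∣n = subst (r ∣_) (sym n≡) (n∣m*n (q ^ e))
  q^e∣n : q ^ e ∣ n
  q^e∣n = subst (q ^ e ∣_) (sym n≡) (m∣m*n r)
  divisors-in-Ps′ : ∀ p → Prime p → p ∣ r → p ∈ Ps
  divisors-in-Ps′ p p-prime p∣r with divisors-in-Ps p p-prime (∣-trans p∣r r∣n)
  ... | here refl = contradiction p∣r q∤r
  ... | there p∈Ps = p∈Ps
  r≤ : r ≤ M ^ length Ps
  r≤ = ≤-from-prime-powers M Ps r {{r≢0}} 1≤M Ps-prime divisors-in-Ps′
         (λ p e p-prime p^e∣r → powers≤M p e p-prime (∣-trans p^e∣r r∣n))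

primesIn : ℕ → ℕ → List ℕ
primesIn K zero    = []
primesIn K (suc n) with prime? (suc n) | K ≤? suc n
... | yes _ | yes _ = suc n ∷ primesIn K n
... | yes _ | no  _ = primesIn K n
... | no  _ | _     = primesIn K n

π : ℕ → ℕ
π n = length (primesIn 0 n)

∈-primesIn : ∀ K n {q} → Prime q → K ≤ q → q ≤ n → q ∈ primesIn K n
∈-primesIn K zero    q-prime _   q≤0 = contradiction q≤0 (<⇒≱ (m<n⇒0<n (prime>1 q-prime)))
∈-primesIn K (suc n) {q} q-prime K≤q q≤n with prime? (suc n) | K ≤? suc n | m≤n⇒m<n∨m≡n q≤n
... | yes _ | yes _   | inj₂ refl = here refl
... | yes _ | no  K≰q | inj₂ refl = contradiction K≤q K≰q
... | no  ¬p | _      | inj₂ refl = contradiction q-prime ¬p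
... | yes _ | yes _   | inj₁ q<n  = there (∈-primesIn K n q-prime K≤q (≤-pred q<n))
... | yes _ | no  _   | inj₁ q<n  = ∈-primesIn K n q-prime K≤q (≤-pred q<n)
... | no  _ | _       | inj₁ q<n  = ∈-primesIn K n q-prime K≤q (≤-pred q<n)

primesIn-sound : ∀ K n → All (λ q → Prime q × K ≤ q × q ≤ n) (primesIn K n)
primesIn-sound K zero    = []
primesIn-sound K (suc n) with prime? (suc n) | K ≤? suc n
... | yes q-prime | yes K≤q =
  (q-prime , K≤q , ≤-refl) ∷ All.map (map₂ (map₂ m≤n⇒m≤1+n)) (primesIn-sound K n)
... | yes _       | no  _   = All.map (map₂ (map₂ m≤n⇒m≤1+n)) (primesIn-sound K n)
... | no  _       | _       = All.map (map₂ (map₂ m≤n⇒m≤1+n)) (primesIn-sound K n)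

-- the list is strictly decreasing, so its entries are distinct
primesIn-distinct : ∀ K n → AllPairs _≢_ (primesIn K n)
primesIn-distinct K zero    = []
primesIn-distinct K (suc n) with prime? (suc n) | K ≤? suc n
... | yes _ | yes _ = All.map (λ (_ , _ , q≤n) → ≢-sym (<⇒≢ (s≤s q≤n))) (primesIn-sound K n)
                      ∷ primesIn-distinct K n
... | yes _ | no  _ = primesIn-distinct K n
... | no  _ | _     = primesIn-distinct K n

|primesIn|≤ : ∀ K n → length (primesIn K n) ≤ n
|primesIn|≤ K zero    = z≤n
|primesIn|≤ K (suc n) with prime? (suc n) | K ≤? suc n
... | yes _ | yes _ = s≤s (|primesIn|≤ K n)
... | yes _ | no  _ = m≤n⇒m≤1+n (|primesIn|≤ K n)
... | no  _ | _     = m≤n⇒m≤1+n (|primesIn|≤ K n)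

-- At most K primes lie below K.
π≤K+|primesIn| : ∀ K n → π n ≤ K + length (primesIn K n)
π≤K+|primesIn| K zero    = z≤n
π≤K+|primesIn| K (suc n) with prime? (suc n) | 0 ≤? suc n | K ≤? suc n
... | no  _ | _     | _     = π≤K+|primesIn| K n
... | yes _ | no 0≰ | _     = contradiction z≤n 0≰
... | yes _ | yes _ | yes _ = ≤-trans (s≤s (π≤K+|primesIn| K n)) (≤-reflexive (sym (+-suc K _)))
... | yes _ | yes _ | no K≰ = ≤-trans (s≤s (|primesIn|≤ 0 n)) (≤-trans (<⇒≤ (≰⇒> K≰)) (m≤m+n K _))

-- (2N)! ≥ 2^N · (N!)²: passing from N to N + 1 multiplies the right side by
-- (2N+2)(2N+1) and the left side by 2(N+1)².
central-binomial-growth : ∀ N → 2 ^ N * (N ! * N !) ≤ (N + N) !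
central-binomial-growth zero    = ≤-refl
central-binomial-growth (suc N) = begin
  2 ^ suc N * (suc N ! * suc N !)               ≡⟨ expand-left (2 ^ N) (N !) N ⟩
  B * ((N + N + 2) * (N + 1))                   ≤⟨ *-monoʳ-≤ B (*-monoʳ-≤ (N + N + 2) (m≤n+m (N + 1) N)) ⟩
  B * ((N + N + 2) * (N + (N + 1)))             ≤⟨ *-monoˡ-≤ _ (central-binomial-growth N) ⟩
  (N + N) ! * ((N + N + 2) * (N + (N + 1)))     ≡⟨ expand-right ((N + N) !) N ⟩
  suc (suc (N + N)) * (suc (N + N) * (N + N) !) ≡⟨ cong (λ n → suc n !) (+-suc N N) ⟨
  (suc N + suc N) !                             ∎
  where
  open ≤-Reasoning
  B : ℕ
  B = 2 ^ N * (N ! * N !)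
  expand-left : ∀ P F N → 2 * P * (suc N * F * (suc N * F)) ≡ P * (F * F) * ((N + N + 2) * (N + 1))
  expand-left = solve-∀
  expand-right : ∀ F N → F * ((N + N + 2) * (N + (N + 1))) ≡ suc (suc (N + N)) * (suc (N + N) * F)
  expand-right = solve-∀

central-binomial : ∀ N → ∃[ X ] X * (N ! * N !) ≡ (N + N) !
central-binomial N with k![n∸k]!∣n! {N + N} {N} (m≤m+n N N)
... | divides X eq = X , sym (subst (λ n → (N + N) ! ≡ X * (N ! * n !)) (m+n∸m≡n N N) eq)

-- Chebyshev's lower bound: 2^N ≤ X ≤ (2N)^π(2N), because every prime power
-- dividing the central binomial coefficient X is at most 2N.
chebyshev : ∀ N → 1 ≤ N → 2 ^ N ≤ (N + N) ^ π (N + N)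
chebyshev N 1≤N with central-binomial N
... | X , X-def = begin
  2 ^ N               ≤⟨ 2^N≤X ⟩
  X                   ≤⟨ ≤-from-prime-powers (N + N) (primesIn 0 (N + N)) X {{X≢0}} 1≤2N
                           (All.map proj₁ (primesIn-sound 0 (N + N))) divisors-listed powers≤2N ⟩
  (N + N) ^ π (N + N) ∎
  where
  open ≤-Reasoning
  1≤2N : 1 ≤ N + N
  1≤2N = ≤-trans 1≤N (m≤m+n N N)
  2^N≤X : 2 ^ N ≤ X
  2^N≤X = *-cancelʳ-≤ (2 ^ N) X (N ! * N !) {{N !* N !≢0}}
            (subst (2 ^ N * (N ! * N !) ≤_) (sym X-def) (central-binomial-growth N))
  X≢0 : NonZero X
  X≢0 = >-nonZero (≤-trans (m^n>0 2 N) 2^N≤X)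
  powers≤2N : ∀ p e → Prime p → p ^ e ∣ X → p ^ e ≤ N + N
  powers≤2N p e p-prime = Legendre.central-binomial-prime-power p p-prime N X e 1≤N X-def
  divisors-listed : ∀ p → Prime p → p ∣ X → p ∈ primesIn 0 (N + N)
  divisors-listed p p-prime p∣X = ∈-primesIn 0 (N + N) p-prime z≤n
    (subst (_≤ N + N) (*-identityʳ p) (powers≤2N p 1 p-prime (subst (_∣ X) (sym (*-identityʳ p)) p∣X)))

common-divisor≤gap : ∀ {d} n {x y} → d ∣ n + x → d ∣ n + y → x < y → d ≤ y ∸ x
common-divisor≤gap {d} n {x} {y} d∣n+x d∣n+y x<y = ∣⇒≤ {{>-nonZero (m<n⇒0<n∸m x<y)}} d∣gap
  where
  n+y≡ : n + y ≡ (n + x) + (y ∸ x)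
  n+y≡ = trans (cong (n +_) (sym (m+[n∸m]≡n (<⇒≤ x<y)))) (sym (+-assoc n x (y ∸ x)))
  d∣gap : d ∣ y ∸ x
  d∣gap = ∣m+n∣m⇒∣n (subst (d ∣_) n+y≡ d∣n+y) d∣n+x

-- For a fixed i, the K multiples qᵢ·(b+1), …, qᵢ·(b+K)
-- of qᵢ following b·qᵢ, b = ⌊a/qᵢ⌋, lie in [a, a+m).  Another q_l divides at
-- most one of them (two would be ≡ mod q_l but closer than K ≤ q_l), and there
-- are only k − 1 < K other primes, so some multiple of qᵢ avoids them all.
module Sieve (m a K k : ℕ) (q : Fin k → ℕ) (q-prime : ∀ l → Prime (q l))
             (q-injective : ∀ l l′ → q l ≡ q l′ → l ≡ l′) (K≤q : ∀ l → K ≤ q l)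
             (qK<m : ∀ l → q l * K < m) (k≤K : k ≤ K) where

  module Candidates (i : Fin k) where

    instance
      qᵢ≢0 : NonZero (q i)
      qᵢ≢0 = prime⇒nonZero (q-prime i)

    b : ℕ
    b = a / q i

    candidate : Fin K → ℕ
    candidate j = q i * (b + suc (toℕ j))

    candidate-in-window : ∀ j → a ≤ candidate j × candidate j < a + m
    candidate-in-window j = lower , upper
      where
      open ≤-Reasoning
      lower : a ≤ candidate j
      lower = begin
        a                           ≡⟨ trans (m≡m%n+[m/n]*n a (q i)) (+-comm (a % q i) (b * q i)) ⟩
        b * q i + a % q i           ≤⟨ +-monoʳ-≤ (b * q i) (<⇒≤ (m%n<n a (q i))) ⟩
        b * q i + q i               ≤⟨ +-monoʳ-≤ (b * q i) (m≤m*n (q i) (suc (toℕ j))) ⟩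
        b * q i + q i * suc (toℕ j) ≡⟨ cong (_+ q i * suc (toℕ j)) (*-comm b (q i)) ⟩
        q i * b + q i * suc (toℕ j) ≡⟨ *-distribˡ-+ (q i) b (suc (toℕ j)) ⟨
        candidate j                 ∎
      qᵢb≤a : q i * b ≤ a
      qᵢb≤a = subst (_≤ a) (*-comm b (q i)) (m/n*n≤m a (q i))
      upper : candidate j < a + m
      upper = begin-strict
        candidate j                 ≡⟨ *-distribˡ-+ (q i) b (suc (toℕ j)) ⟩
        q i * b + q i * suc (toℕ j) ≤⟨ +-monoˡ-≤ (q i * suc (toℕ j)) qᵢb≤a ⟩
        a + q i * suc (toℕ j)       ≤⟨ +-monoʳ-≤ a (*-monoʳ-≤ (q i) (toℕ<n j)) ⟩
        a + q i * K                 <⟨ +-monoʳ-< a (qK<m i) ⟩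
        a + m                       ∎

    Struck : Fin K → Set
    Struck j = ∃[ l ] l ≢ i × q l ∣ candidate j

    struck? : ∀ j → Dec (Struck j)
    struck? j = any? (λ l → ¬? (l Fin.≟ i) ×-dec (q l ∣? candidate j))

    other∤qᵢ : ∀ l → l ≢ i → ¬ q l ∣ q i
    other∤qᵢ l l≢i qₗ∣qᵢ with prime⇒irreducible (q-prime i) qₗ∣qᵢ
    ... | inj₁ qₗ≡1 = <⇒≢ (prime>1 (q-prime l)) (sym qₗ≡1)
    ... | inj₂ qₗ≡qᵢ = l≢i (q-injective l i qₗ≡qᵢ)

    struck-once : ∀ l → l ≢ i → ∀ j j′ → q l ∣ candidate j → q l ∣ candidate j′
                → toℕ j < toℕ j′ → ⊥
    struck-once l l≢i j j′ qₗ∣c qₗ∣c′ j<j′ = <⇒≱ gap<K (≤-trans (K≤q l) qₗ≤gap)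
      where
      cancel-qᵢ : ∀ {n} → q l ∣ q i * n → q l ∣ n
      cancel-qᵢ qₗ∣ with euclidsLemma (q i) _ (q-prime l) qₗ∣
      ... | inj₁ qₗ∣qᵢ = contradiction qₗ∣qᵢ (other∤qᵢ l l≢i)
      ... | inj₂ qₗ∣n  = qₗ∣n
      qₗ≤gap : q l ≤ toℕ j′ ∸ toℕ j
      qₗ≤gap = common-divisor≤gap b (cancel-qᵢ qₗ∣c) (cancel-qᵢ qₗ∣c′) (s≤s j<j′)
      gap<K : toℕ j′ ∸ toℕ j < K
      gap<K = ≤-<-trans (m∸n≤m (toℕ j′) (toℕ j)) (toℕ<n j′)

    -- Pigeonhole: if all K candidates were struck, label each by a striking
    -- prime's index and add one extra pigeon labelled i; K + 1 pigeons in
    -- k ≤ K holes force two candidates struck by the same prime.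
    survivor : ∃[ j ] ¬ Struck j
    survivor with all? struck?
    ... | no  ¬all = ¬∀⟶∃¬ K Struck struck? ¬all
    ... | yes all  = ⊥-elim (collision (pigeonhole (s≤s k≤K) striker))
      where
      striker : Fin (suc K) → Fin k
      striker zero    = i
      striker (suc j) = proj₁ (all j)
      collision : ∃[ j ] ∃[ j′ ] j Fin.< j′ × striker j ≡ striker j′ → ⊥
      collision (zero  , suc j′ , _       , i≡l) = proj₁ (proj₂ (all j′)) (sym i≡l)
      collision (suc j , suc j′ , s≤s j<j′ , l≡l′) =
        struck-once (proj₁ (all j)) (proj₁ (proj₂ (all j))) j j′ (proj₂ (proj₂ (all j)))
          (subst (λ l → q l ∣ candidate j′) (sym l≡l′) (proj₂ (proj₂ (all j′)))) j<j′

  private-multiple : ∀ i → ∃[ y ] (a ≤ y × y < a + m) × q i ∣ y × (∀ l → l ≢ i → ¬ q l ∣ y)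
  private-multiple i with Candidates.survivor i
  ... | j , unstruck = Candidates.candidate i j , Candidates.candidate-in-window i j
                     , m∣m*n _ , λ l l≢i qₗ∣y → unstruck (l , l≢i , qₗ∣y)

  independent-in-window : Σ (Fin k → ℕ) λ x → (∀ l → a ≤ x l × x l < a + m) × MultIndependent k x
  independent-in-window = x , (λ l → proj₁ (proj₂ (private-multiple l)))
                        , PrivatePrimes.independent x q q-prime q∣x q∤x
    where
    x : Fin k → ℕ
    x l = proj₁ (private-multiple l)
    q∣x : ∀ l → q l ∣ x l
    q∣x l = proj₁ (proj₂ (proj₂ (private-multiple l)))
    q∤x : ∀ l l′ → l ≢ l′ → ¬ q l ∣ x l′
    q∤x l l′ l≢l′ = proj₂ (proj₂ (proj₂ (private-multiple l′))) l l≢l′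

lookup-injective : ∀ {xs : List ℕ} → AllPairs _≢_ xs → ∀ i j → lookup xs i ≡ lookup xs j → i ≡ j
lookup-injective (_ ∷ _)    zero    zero    _  = refl
lookup-injective (x≢ ∷ _)   zero    (suc j) eq = contradiction eq (All.lookup x≢ (∈-lookup j))
lookup-injective (x≢ ∷ _)   (suc i) zero    eq = contradiction (sym eq) (All.lookup x≢ (∈-lookup i))
lookup-injective (_ ∷ xs≢)  (suc i) (suc j) eq = cong suc (lookup-injective xs≢ i j eq)

independent-from-primes : ∀ m a K C → K + K ≤ π C → C * K < m
  → Σ (Fin K → ℕ) λ x → (∀ l → a ≤ x l × x l < a + m) × MultIndependent K x
independent-from-primes m a K C 2K≤πC CK<m =
  Sieve.independent-in-window m a K K q q-prime q-injective K≤q qK<m ≤-refl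
  where
  ps : List ℕ
  ps = primesIn K C
  K≤|ps| : K ≤ length ps
  K≤|ps| = +-cancelˡ-≤ K K (length ps) (≤-trans 2K≤πC (π≤K+|primesIn| K C))
  index : Fin K → Fin (length ps)
  index l = Fin.inject≤ l K≤|ps|
  q : Fin K → ℕ
  q l = lookup ps (index l)
  q-sound : ∀ l → Prime (q l) × K ≤ q l × q l ≤ C
  q-sound l = All.lookup (primesIn-sound K C) (∈-lookup (index l))
  q-prime : ∀ l → Prime (q l)
  q-prime l = proj₁ (q-sound l)
  K≤q : ∀ l → K ≤ q l
  K≤q l = proj₁ (proj₂ (q-sound l))
  qK<m : ∀ l → q l * K < m
  qK<m l = ≤-<-trans (*-monoˡ-≤ K (proj₂ (proj₂ (q-sound l)))) CK<m
  q-injective : ∀ l l′ → q l ≡ q l′ → l ≡ l′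
  q-injective l l′ eq = inject≤-injective K≤|ps| K≤|ps| l l′
                          (lookup-injective (primesIn-distinct K C) (index l) (index l′) eq)

^-cancelʳ-≤ : ∀ x → 1 < x → ∀ {a b} → x ^ a ≤ x ^ b → a ≤ b
^-cancelʳ-≤ x 1<x {a} {b} x^a≤x^b with a ≤? b
... | yes a≤b = a≤b
... | no  a≰b = contradiction x^a≤x^b (<⇒≱ (^-monoʳ-< x 1<x (≰⇒> a≰b)))

2^[1+n]≡2^n+2^n : ∀ n → 2 ^ suc n ≡ 2 ^ n + 2 ^ n
2^[1+n]≡2^n+2^n n = cong (2 ^ n +_) (+-identityʳ (2 ^ n))

2^⌊log₂n⌋≤n : ∀ n → 1 ≤ n → 2 ^ ⌊log₂ n ⌋ ≤ n
2^⌊log₂n⌋≤n = <-rec (λ n → 1 ≤ n → 2 ^ ⌊log₂ n ⌋ ≤ n) step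
  where
  step : ∀ n → (∀ {h} → h < n → 1 ≤ h → 2 ^ ⌊log₂ h ⌋ ≤ h) → 1 ≤ n → 2 ^ ⌊log₂ n ⌋ ≤ n
  step (suc zero)    _   _ = ≤-refl
  step (suc (suc k)) rec _ = begin
    2 ^ ⌊log₂ n ⌋                ≡⟨ cong (2 ^_) (m+[n∸m]≡n (⌊log₂⌋-mono-≤ {2} {n} (s≤s (s≤s z≤n)))) ⟨
    2 * 2 ^ (⌊log₂ n ⌋ ∸ 1)      ≡⟨ cong (λ e → 2 * 2 ^ e) (⌊log₂⌊n/2⌋⌋≡⌊log₂n⌋∸1 n) ⟨
    2 * 2 ^ ⌊log₂ ⌊ n /2⌋ ⌋      ≤⟨ *-monoʳ-≤ 2 (rec (⌊n/2⌋<n (suc k)) (s≤s z≤n)) ⟩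
    2 * ⌊ n /2⌋                  ≡⟨ cong (⌊ n /2⌋ +_) (+-identityʳ ⌊ n /2⌋) ⟩
    ⌊ n /2⌋ + ⌊ n /2⌋            ≤⟨ +-monoʳ-≤ ⌊ n /2⌋ (⌊n/2⌋≤⌈n/2⌉ n) ⟩
    ⌊ n /2⌋ + ⌈ n /2⌉            ≡⟨ ⌊n/2⌋+⌈n/2⌉≡n n ⟩
    n                            ∎
    where
    open ≤-Reasoning
    n : ℕ
    n = suc (suc k)

n<2^[1+⌊log₂n⌋] : ∀ n → n < 2 ^ suc ⌊log₂ n ⌋
n<2^[1+⌊log₂n⌋] n with 2 ^ suc ⌊log₂ n ⌋ ≤? n
... | no  n≱ = ≰⇒> n≱
... | yes n≥ = contradiction (subst (_≤ ⌊log₂ n ⌋) (⌊log₂[2^n]⌋≡n (suc ⌊log₂ n ⌋)) (⌊log₂⌋-mono-≤ n≥))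
                             (<-irrefl refl)

half-bounds : ∀ r → ⌊ r /2⌋ + ⌊ r /2⌋ ≤ r × r ≤ suc (⌊ r /2⌋ + ⌊ r /2⌋)
half-bounds zero          = z≤n , z≤n
half-bounds (suc zero)    = z≤n , ≤-refl
half-bounds (suc (suc r)) rewrite +-suc ⌊ r /2⌋ ⌊ r /2⌋ =
  s≤s (s≤s (proj₁ (half-bounds r))) , s≤s (s≤s (proj₂ (half-bounds r)))

-- The choice of parameters for a window of length m ≥ 2.  With L = ⌊log₂ m⌋
-- and u = 1 + ⌊log₂ L⌋ (so L < 2^u ≤ 2L), take K = 2^t, t = ⌊(L − u − 3)/2⌋,
-- and C = 2^(u+t+2).  Then m < 2^(L+1) ≤ 64·K²·L² always, and if L ≥ u + 3
-- Chebyshev's bound yields 2K primes up to C while C·K < m.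
module Parameters (m : ℕ) where

  L u t K s C : ℕ
  L = ⌊log₂ m ⌋
  u = suc ⌊log₂ L ⌋
  t = ⌊ (L ∸ (u + 3)) /2⌋
  K = 2 ^ t
  s = u + suc t
  C = 2 ^ suc s

  module _ (2≤m : 2 ≤ m) where

    1≤L : 1 ≤ L
    1≤L = ⌊log₂⌋-mono-≤ 2≤m

    2^u≤L+L : 2 ^ u ≤ L + L
    2^u≤L+L = begin
      2 * 2 ^ ⌊log₂ L ⌋ ≤⟨ *-monoʳ-≤ 2 (2^⌊log₂n⌋≤n L 1≤L) ⟩
      2 * L             ≡⟨ cong (L +_) (+-identityʳ L) ⟩
      L + L             ∎
      where open ≤-Reasoning

    -- L + 1 ≤ 2t + u + 5, since L − u − 3 ≤ 2t + 1
    exponent-budget : suc L ≤ (t + t) + (u + 5)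
    exponent-budget = begin
      suc L                                 ≤⟨ s≤s (m≤n+m∸n L (u + 3)) ⟩
      suc ((u + 3) + (L ∸ (u + 3)))         ≤⟨ s≤s (+-monoʳ-≤ (u + 3) (proj₂ (half-bounds (L ∸ (u + 3))))) ⟩
      suc ((u + 3) + suc (t + t))           ≡⟨ regroup u t ⟩
      (t + t) + (u + 5)                     ∎
      where
      open ≤-Reasoning
      regroup : ∀ u t → suc ((u + 3) + suc (t + t)) ≡ (t + t) + (u + 5)
      regroup = solve-∀

    size-bound : m ≤ 8 * 8 * (K * K) * (L * L)
    size-bound = begin
      m                              ≤⟨ <⇒≤ (n<2^[1+⌊log₂n⌋] m) ⟩
      2 ^ suc L                      ≤⟨ ^-monoʳ-≤ 2 exponent-budget ⟩
      2 ^ ((t + t) + (u + 5))        ≡⟨ ^-distribˡ-+-* 2 (t + t) (u + 5) ⟩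
      2 ^ (t + t) * 2 ^ (u + 5)      ≡⟨ cong₂ _*_ (^-distribˡ-+-* 2 t t) (^-distribˡ-+-* 2 u 5) ⟩
      K * K * (2 ^ u * 32)           ≤⟨ *-monoʳ-≤ (K * K) (*-monoˡ-≤ 32 2^u≤L+L) ⟩
      K * K * ((L + L) * 32)         ≡⟨ regroup (K * K) L ⟩
      8 * 8 * (K * K) * L            ≤⟨ *-monoʳ-≤ (8 * 8 * (K * K)) (m≤m*n L L {{>-nonZero 1≤L}}) ⟩
      8 * 8 * (K * K) * (L * L)      ∎
      where
      open ≤-Reasoning
      regroup : ∀ k l → k * ((l + l) * 32) ≡ 8 * 8 * k * l
      regroup = solve-∀

    module Room (room : u + 3 ≤ L) where

      2t+u+3≤L : (t + t) + (u + 3) ≤ L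
      2t+u+3≤L = m≤o∸n⇒m+n≤o (t + t) room (proj₁ (half-bounds (L ∸ (u + 3))))

      s+t+2≡ : suc s + suc t ≡ (t + t) + (u + 3)
      s+t+2≡ = regroup u t
        where
        regroup : ∀ u t → suc (u + suc t) + suc t ≡ (t + t) + (u + 3)
        regroup = solve-∀

      window-fits : C * K < m
      window-fits = begin-strict
        C * K                   ≡⟨ ^-distribˡ-+-* 2 (suc s) t ⟨
        2 ^ (suc s + t)         <⟨ ^-monoʳ-< 2 ≤-refl (n<1+n (suc s + t)) ⟩
        2 ^ suc (suc s + t)     ≡⟨ cong (2 ^_) (trans (sym (+-suc (suc s) t)) s+t+2≡) ⟩
        2 ^ ((t + t) + (u + 3)) ≤⟨ ^-monoʳ-≤ 2 2t+u+3≤L ⟩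
        2 ^ L                   ≤⟨ 2^⌊log₂n⌋≤n m (≤-trans (s≤s z≤n) 2≤m) ⟩
        m                       ∎
        where open ≤-Reasoning

      -- Chebyshev with N = 2^s: 2^s ≤ (s+1)·π(C), and s + 1 ≤ L < 2^u.
      enough-primes : K + K ≤ π C
      enough-primes = subst (_≤ π C) (2^[1+n]≡2^n+2^n t)
        (*-cancelˡ-≤ (2 ^ u) {{m^n≢0 2 u}} (begin
          2 ^ u * 2 ^ suc t   ≡⟨ ^-distribˡ-+-* 2 u (suc t) ⟨
          2 ^ s               ≤⟨ ^-cancelʳ-≤ 2 ≤-refl chebyshev-C ⟩
          suc s * π C         ≤⟨ *-monoˡ-≤ (π C) (<⇒≤ s<2^u) ⟩
          2 ^ u * π C         ∎))
        where
        open ≤-Reasoning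
        s<2^u : suc s < 2 ^ u
        s<2^u = ≤-<-trans (≤-trans (m≤m+n (suc s) (suc t)) (≤-trans (≤-reflexive s+t+2≡) 2t+u+3≤L))
                          (n<2^[1+⌊log₂n⌋] L)
        chebyshev-C : 2 ^ (2 ^ s) ≤ 2 ^ (suc s * π C)
        chebyshev-C = begin
          2 ^ (2 ^ s)                         ≤⟨ chebyshev (2 ^ s) (m^n>0 2 s) ⟩
          (2 ^ s + 2 ^ s) ^ π (2 ^ s + 2 ^ s) ≡⟨ cong (λ n → n ^ π n) (2^[1+n]≡2^n+2^n s) ⟨
          C ^ π C                             ≡⟨ ^-*-assoc 2 (suc s) (π C) ⟩
          2 ^ (suc s * π C)                   ∎

  room? : Dec (u + 3 ≤ L)
  room? = u + 3 ≤? L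

  -- without room, t = 0 and the family is a single integer
  cramped⇒K≡1 : ¬ (u + 3 ≤ L) → K ≡ 1
  cramped⇒K≡1 cramped rewrite m≤n⇒m∸n≡0 (<⇒≤ (≰⇒> cramped)) = refl

IndependentInWindow : (d m a : ℕ) → Set
IndependentInWindow d m a = ∃[ k ] Σ (Fin k → ℕ) (λ x →
  ((i : Fin k) → (a ≤ x i) × (x i < a + m))
  × MultIndependent k x
  × (m ≤ (d * d) * (k * k) * (⌊log₂ m ⌋ * ⌊log₂ m ⌋)))

corollary2p8 : ∃[ d ] ((m a : ℕ) → 2 ≤ m → 1 ≤ a →
    ∃[ k ] Σ (Fin k → ℕ) (λ x →
    ((i : Fin k) → (a ≤ x i) × (x i < a + m))
    × MultIndependent k x
    × (m ≤ (d * d) * (k * k) * (⌊log₂ m ⌋ * ⌊log₂ m ⌋))))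
corollary2p8 = 8 , window
  where
  window : (m a : ℕ) → 2 ≤ m → 1 ≤ a → IndependentInWindow 8 m a
  window m a 2≤m 1≤a with Parameters.room? m
  ... | yes room =
    let open Parameters m
        open Room 2≤m room
        (x , in-window , independent) = independent-from-primes m a K C enough-primes window-fits
    in K , x , in-window , independent , size-bound 2≤m
  ... | no cramped =
    let open Parameters m in
    1 , (λ _ → suc a) , (λ _ → n≤1+n a , subst (_≤ a + m) (+-comm a 2) (+-monoʳ-≤ a 2≤m))
      , single-independent (suc a) (s≤s 1≤a)
      , subst (λ k → m ≤ 8 * 8 * (k * k) * (L * L)) (cramped⇒K≡1 cramped) (size-bound 2≤m)
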